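{- The variety of $\mathcal S$-algebras is not finitely generated, i.e., it is not of the form $V(K)$ (the variety generated by $K$) for any finite set $K$ of finite algebras.
   Context: Nelson's logic $\mathcal S$ is the sentential logic in the language $\langle\land,\lor,\Rightarrow,\neg,0\rangle$ given by the following Hilbert-style calculus. Abbreviations: $\phi\Leftrightarrow\psi:=(\phi\Rightarrow\psi)\land(\psi\Rightarrow\phi)$, $1:=\neg 0$, $\phi\Rightarrow^2\psi:=\phi\Rightarrow(\phi\Rightarrow\psi)$; for a finite (possibly empty) list $\Gamma=(\phi_1,\dots,\phi_n)$, $\Gamma\Rightarrow\phi:=\phi_1\Rightarrow(\phi_2\Rightarrow(\cdots(\phi_n\Rightarrow\phi)\cdots))$ and $\Gamma\Rightarrow^2\phi:=\phi_1\Rightarrow^2(\cdots(\phi_n\Rightarrow^2\phi)\cdots)$, both $\phi$ if $\Gamma$ is empty. Axioms: (A1) $\phi\Rightarrow\phi$; (A2) $0\Rightarrow\psi$; (A3) $\neg\phi\Rightarrow(\phi\Rightarrow0)$; (A4) $1$; (A5) $(\phi\Rightarrow\psi)\Leftrightarrow(\neg\psi\Rightarrow\neg\phi)$. Rules ("premisses / conclusion", for every finite list $\Gamma$): (P) $\Gamma\Rightarrow(\phi\Rightarrow(\psi\Rightarrow\gamma))$ / $\Gamma\Rightarrow(\psi\Rightarrow(\phi\Rightarrow\gamma))$; (C) $\phi\Rightarrow(\phi\Rightarrow(\phi\Rightarrow\gamma))$ / $\phi\Rightarrow(\phi\Rightarrow\gamma)$; (E) $\Gamma\Rightarrow\phi$,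 $\phi\Rightarrow\gamma$ / $\Gamma\Rightarrow\gamma$; ($\Rightarrow$l) $\Gamma\Rightarrow\phi$, $\psi\Rightarrow\gamma$ / $\Gamma\Rightarrow((\phi\Rightarrow\psi)\Rightarrow\gamma)$; ($\Rightarrow$r) $\gamma$ / $\phi\Rightarrow\gamma$; ($\land$l1) $\phi\Rightarrow\gamma$ / $(\phi\land\psi)\Rightarrow\gamma$; ($\land$l2) $\psi\Rightarrow\gamma$ / $(\phi\land\psi)\Rightarrow\gamma$; ($\land$r) $\Gamma\Rightarrow\phi$, $\Gamma\Rightarrow\psi$ / $\Gamma\Rightarrow(\phi\land\psi)$; ($\lor$l1) $\phi\Rightarrow\gamma$, $\psi\Rightarrow\gamma$ / $(\phi\lor\psi)\Rightarrow\gamma$; ($\lor$l2) $\phi\Rightarrow^2\gamma$, $\psi\Rightarrow^2\gamma$ / $(\phi\lor\psi)\Rightarrow^2\gamma$; ($\lor$r1) $\Gamma\Rightarrow\phi$ / $\Gamma\Rightarrow(\phi\lor\psi)$; ($\lor$r2) $\Gamma\Rightarrow\psi$ / $\Gamma\Rightarrow(\phi\lor\psi)$; ($\neg\Rightarrow$l) $(\phi\land\neg\psi)\Rightarrow\gamma$ / $\neg(\phi\Rightarrow\psi)\Rightarrow\gamma$; ($\neg\Rightarrow$r) $\Gamma\Rightarrow^2(\phi\land\neg\psi)$ / $\Gamma\Rightarrow^2\neg(\phi\Rightarrow\psi)$; ($\neg\land$l) $(\neg\phi\lor\neg\psi)\Rightarrow\gamma$ / $\neg(\phi\land\psi)\Rightarrow\gamma$;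 ($\neg\land$r) $\Gamma\Rightarrow(\neg\phi\lor\neg\psi)$ / $\Gamma\Rightarrow\neg(\phi\land\psi)$; ($\neg\lor$l) $(\neg\phi\land\neg\psi)\Rightarrow\gamma$ / $\neg(\phi\lor\psi)\Rightarrow\gamma$; ($\neg\lor$r) $\Gamma\Rightarrow(\neg\phi\land\neg\psi)$ / $\Gamma\Rightarrow\neg(\phi\lor\psi)$; ($\neg\neg$l) $\phi\Rightarrow\gamma$ / $\neg\neg\phi\Rightarrow\gamma$; ($\neg\neg$r) $\Gamma\Rightarrow\phi$ / $\Gamma\Rightarrow\neg\neg\phi$. An $\mathcal S$-algebra is an algebra $\langle A,\land,\lor,\Rightarrow,\neg,0,1\rangle$ of type $\langle2,2,2,1,0,0\rangle$ satisfying: (i) $\varphi\approx1$ for every axiom (A1)–(A5), formulas read as terms and the abbreviation $1:=\neg0$ written out (so (A4) gives $\neg0\approx1$); (ii) $x\Rightarrow x\approx1$; (iii) for each rule with premisses $\varphi_1,\dots,\varphi_n$ and conclusion $\varphi$, the quasi-equation $(\varphi_1\approx1\ \&\cdots\&\ \varphi_n\approx1)\Longrightarrow\varphi\approx1$; (iv) $(x\Rightarrow y\approx1\ \&\ y\Rightarrow x\approx1)\Longrightarrow x\approx y$. (The class of $\mathcal S$-algebras is a variety.) -}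

module Defs where

open import Data.Nat using (ℕ)
open import Data.Fin using (Fin)
open import Data.List using (List; foldr)
open import Data.List.Relation.Unary.All using (All)
open import Data.Product using (Σ; _×_; _,_; proj₁; proj₂)
open import Relation.Binary.PropositionalEquality using (_≡_)

record Ops (A : Set) : Set where
  field
    _∧_ _∨_ _⇒_ : A → A → A
    ¬_ : A → A
    𝟘 𝟙 : A
  infixr 6 _∧_
  infixr 5 _∨_
  infixr 4 _⇒_
  infix 7 ¬_

  _⇔_ : A → A → A
  x ⇔ y = (x ⇒ y) ∧ (y ⇒ x)

  _⇒²_ : A → A → A
  x ⇒² y = x ⇒ (x ⇒ y)

  _⇛_ : List A → A → A
  Γ ⇛ x = foldr _⇒_ x Γ

  _⇛²_ : List A → A → A
  Γ ⇛² x = foldr _⇒²_ x Γ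

record IsSAlgebra {A : Set} (O : Ops A) : Set where
  open Ops O
  field
    A1 : ∀ x → (x ⇒ x) ≡ 𝟙
    A2 : ∀ y → (𝟘 ⇒ y) ≡ 𝟙
    A3 : ∀ x → (¬ x ⇒ (x ⇒ 𝟘)) ≡ 𝟙
    A4 : ¬ 𝟘 ≡ 𝟙
    A5 : ∀ x y → ((x ⇒ y) ⇔ (¬ y ⇒ ¬ x)) ≡ 𝟙
    refl⇒ : ∀ x → (x ⇒ x) ≡ 𝟙
    rP : ∀ (Γ : List A) x y g → (Γ ⇛ (x ⇒ (y ⇒ g))) ≡ 𝟙 → (Γ ⇛ (y ⇒ (x ⇒ g))) ≡ 𝟙
    rC : ∀ x g → (x ⇒ (x ⇒ (x ⇒ g))) ≡ 𝟙 → (x ⇒ (x ⇒ g)) ≡ 𝟙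
    rE : ∀ (Γ : List A) x g → (Γ ⇛ x) ≡ 𝟙 → (x ⇒ g) ≡ 𝟙 → (Γ ⇛ g) ≡ 𝟙
    r⇒l : ∀ (Γ : List A) x y g → (Γ ⇛ x) ≡ 𝟙 → (y ⇒ g) ≡ 𝟙 → (Γ ⇛ ((x ⇒ y) ⇒ g)) ≡ 𝟙
    r⇒r : ∀ x g → g ≡ 𝟙 → (x ⇒ g) ≡ 𝟙
    r∧l1 : ∀ x y g → (x ⇒ g) ≡ 𝟙 → ((x ∧ y) ⇒ g) ≡ 𝟙
    r∧l2 : ∀ x y g → (y ⇒ g) ≡ 𝟙 → ((x ∧ y) ⇒ g) ≡ 𝟙
    r∧r : ∀ (Γ : List A) x y → (Γ ⇛ x) ≡ 𝟙 → (Γ ⇛ y) ≡ 𝟙 → (Γ ⇛ (x ∧ y)) ≡ 𝟙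
    r∨l1 : ∀ x y g → (x ⇒ g) ≡ 𝟙 → (y ⇒ g) ≡ 𝟙 → ((x ∨ y) ⇒ g) ≡ 𝟙
    r∨l2 : ∀ x y g → (x ⇒² g) ≡ 𝟙 → (y ⇒² g) ≡ 𝟙 → ((x ∨ y) ⇒² g) ≡ 𝟙
    r∨r1 : ∀ (Γ : List A) x y → (Γ ⇛ x) ≡ 𝟙 → (Γ ⇛ (x ∨ y)) ≡ 𝟙
    r∨r2 : ∀ (Γ : List A) x y → (Γ ⇛ y) ≡ 𝟙 → (Γ ⇛ (x ∨ y)) ≡ 𝟙
    r¬⇒l : ∀ x y g → ((x ∧ ¬ y) ⇒ g) ≡ 𝟙 → (¬ (x ⇒ y) ⇒ g) ≡ 𝟙
    r¬⇒r : ∀ (Γ : List A) x y → (Γ ⇛² (x ∧ ¬ y)) ≡ 𝟙 → (Γ ⇛² (¬ (x ⇒ y))) ≡ 𝟙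
    r¬∧l : ∀ x y g → ((¬ x ∨ ¬ y) ⇒ g) ≡ 𝟙 → (¬ (x ∧ y) ⇒ g) ≡ 𝟙
    r¬∧r : ∀ (Γ : List A) x y → (Γ ⇛ (¬ x ∨ ¬ y)) ≡ 𝟙 → (Γ ⇛ (¬ (x ∧ y))) ≡ 𝟙
    r¬∨l : ∀ x y g → ((¬ x ∧ ¬ y) ⇒ g) ≡ 𝟙 → (¬ (x ∨ y) ⇒ g) ≡ 𝟙
    r¬∨r : ∀ (Γ : List A) x y → (Γ ⇛ (¬ x ∧ ¬ y)) ≡ 𝟙 → (Γ ⇛ (¬ (x ∨ y))) ≡ 𝟙
    r¬¬l : ∀ x g → (x ⇒ g) ≡ 𝟙 → (¬ ¬ x ⇒ g) ≡ 𝟙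
    r¬¬r : ∀ (Γ : List A) x → (Γ ⇛ x) ≡ 𝟙 → (Γ ⇛ (¬ ¬ x)) ≡ 𝟙
    antisym : ∀ x y → (x ⇒ y) ≡ 𝟙 → (y ⇒ x) ≡ 𝟙 → x ≡ y

data Term : Set where
  var : ℕ → Term
  and or imp : Term → Term → Term
  neg : Term → Term
  zer one : Term

eval : {A : Set} → Ops A → (ℕ → A) → Term → A
eval O ρ (var i) = ρ i
eval O ρ (and t s) = Ops._∧_ O (eval O ρ t) (eval O ρ s)
eval O ρ (or t s) = Ops._∨_ O (eval O ρ t) (eval O ρ s)
eval O ρ (imp t s) = Ops._⇒_ O (eval O ρ t) (eval O ρ s)
eval O ρ (neg t) = Ops.¬_ O (eval O ρ t)
eval O ρ zer = Ops.𝟘 O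
eval O ρ one = Ops.𝟙 O

_⊨_≈_ : {A : Set} → Ops A → Term → Term → Set
O ⊨ t ≈ s = ∀ (ρ : ℕ → _) → eval O ρ t ≡ eval O ρ s

FinAlg : Set
FinAlg = Σ ℕ (λ n → Ops (Fin n))

-- Membership in the variety V(K) generated by a finite list K of finite
-- algebras: A satisfies every identity holding in all members of K
-- (V(K) = Mod(Id(K)), Birkhoff).
InV : List FinAlg → {A : Set} → Ops A → Set
InV K O = ∀ t s → All (λ B → proj₂ B ⊨ t ≈ s) K → O ⊨ t ≈ s

SAlgIsGeneratedBy : List FinAlg → Set₁
SAlgIsGeneratedBy K = ∀ (A : Set) (O : Ops A) → (IsSAlgebra O → InV K O) × (InV K O → IsSAlgebra O)

-- The term  someEquivalent k  is the disjunction of all  xᵢ ⇔ xⱼ  with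
-- i < j < k.  In an S-algebra it evaluates to 1 at every valuation identifying
-- two of x₀ … x_{k-1}; hence, by pigeonhole, an S-algebra with at most M
-- elements satisfies  someEquivalent (M+1) ≈ 1  (section 1).  Conversely, in a
-- nontrivial well-connected S-algebra it evaluates to 1 only at such valuations.
-- Every decidable chain with least element and order-reversing involution is a
-- well-connected S-algebra under the Nelson implication (section 2); the chain
-- ω + ω* is an infinite one (section 3).  If V(K) were the variety of
-- S-algebras, the members of K would be S-algebras and satisfy the identity for
-- M their total size, so the S-algebra ω + ω* would satisfy it too; but it fails
-- there at the injective valuation i ↦ inj₁ i (section 4).
module Submission where

open import Defs
open import Data.Empty using (⊥-elim)
open import Data.Fin using (Fin; toℕ)
import Data.Fin.Properties as Fin
open import Data.List using (List; []; _∷_; foldr)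
open import Data.List.Membership.Propositional using (_∈_)
open import Data.List.Relation.Unary.All as All using (All)
open import Data.List.Relation.Unary.Any using (here; there)
open import Data.Nat using (ℕ; zero; suc; _+_; z≤n; s≤s) renaming (_≤_ to _≤ℕ_; _<_ to _<ℕ_)
import Data.Nat.Properties as ℕ
open import Data.Product using (Σ; ∃₂; _×_; _,_; proj₁; proj₂)
open import Data.Sum using (_⊎_; inj₁; inj₂)
open import Data.Sum.Properties using (inj₁-injective)
open import Relation.Binary.PropositionalEquality using (_≡_; _≢_; refl; sym; trans; cong; subst; subst₂)
open import Relation.Nullary using (¬_; Dec; yes; no)

-- 1. The separating identities

equivT : Term → Term → Term
equivT t s = and (imp t s) (imp s t)

equivWith : ℕ → ℕ → Term
equivWith j zero = zer
equivWith j (suc i) = or (equivT (var i) (var j)) (equivWith j i)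

someEquivalent : ℕ → Term
someEquivalent zero = zer
someEquivalent (suc j) = or (equivWith j j) (someEquivalent j)

Collision : {A : Set} → (ℕ → A) → ℕ → Set
Collision ρ k = ∃₂ λ i j → i <ℕ j × j <ℕ k × ρ i ≡ ρ j

module SAlgebraFacts {A : Set} {O : Ops A} (S : IsSAlgebra O) where
  open Ops O
  open IsSAlgebra S

  ⇔-refl : ∀ x → (x ⇔ x) ≡ 𝟙
  ⇔-refl x = r∧r [] (x ⇒ x) (x ⇒ x) (refl⇒ x) (refl⇒ x)

  ∧-true₁ : ∀ {x y} → (x ∧ y) ≡ 𝟙 → x ≡ 𝟙
  ∧-true₁ {x} {y} e = rE [] (x ∧ y) x e (r∧l1 x y x (refl⇒ x))

  ∧-true₂ : ∀ {x y} → (x ∧ y) ≡ 𝟙 → y ≡ 𝟙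
  ∧-true₂ {x} {y} e = rE [] (x ∧ y) y e (r∧l2 x y y (refl⇒ y))

  ⇔-true⇒≡ : ∀ {x y} → (x ⇔ y) ≡ 𝟙 → x ≡ y
  ⇔-true⇒≡ e = antisym _ _ (∧-true₁ e) (∧-true₂ e)

  equivWith-true : ∀ (ρ : ℕ → A) {i j} k → i <ℕ k → ρ i ≡ ρ j → eval O ρ (equivWith j k) ≡ 𝟙
  equivWith-true ρ zero () e
  equivWith-true ρ {i} {j} (suc k) i<1+k e with ℕ.m<1+n⇒m<n∨m≡n i<1+k
  ... | inj₁ i<k = r∨r2 [] _ _ (equivWith-true ρ k i<k e)
  ... | inj₂ refl = r∨r1 [] _ _ (subst (λ u → (u ⇔ ρ j) ≡ 𝟙) (sym e) (⇔-refl (ρ j)))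

  someEquivalent-true : ∀ (ρ : ℕ → A) k → Collision ρ k → eval O ρ (someEquivalent k) ≡ 𝟙
  someEquivalent-true ρ (suc k) (i , j , i<j , j<1+k , e) with ℕ.m<1+n⇒m<n∨m≡n j<1+k
  ... | inj₁ j<k = r∨r2 [] _ _ (someEquivalent-true ρ k (i , j , i<j , j<k , e))
  ... | inj₂ refl = r∨r1 [] _ _ (equivWith-true ρ j i<j e)

  module WellConnected (0≢1 : 𝟘 ≢ 𝟙) (∨-prime : ∀ {x y} → (x ∨ y) ≡ 𝟙 → x ≡ 𝟙 ⊎ y ≡ 𝟙) where

    equivWith-collision : ∀ (ρ : ℕ → A) j k → eval O ρ (equivWith j k) ≡ 𝟙 → Σ ℕ λ i → i <ℕ k × ρ i ≡ ρ j
    equivWith-collision ρ j zero e = ⊥-elim (0≢1 e)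
    equivWith-collision ρ j (suc k) e with ∨-prime e
    ... | inj₁ now = k , ℕ.n<1+n k , ⇔-true⇒≡ now
    ... | inj₂ later with equivWith-collision ρ j k later
    ...   | i , i<k , eq = i , ℕ.m<n⇒m<1+n i<k , eq

    someEquivalent-collision : ∀ (ρ : ℕ → A) k → eval O ρ (someEquivalent k) ≡ 𝟙 → Collision ρ k
    someEquivalent-collision ρ zero e = ⊥-elim (0≢1 e)
    someEquivalent-collision ρ (suc j) e with ∨-prime e
    ... | inj₁ now with equivWith-collision ρ j j now
    ...   | i , i<j , eq = i , j , i<j , ℕ.n<1+n j , eq
    someEquivalent-collision ρ (suc j) e | inj₂ later with someEquivalent-collision ρ j later
    ...   | i , i' , i<i' , i'<j , eq = i , i' , i<i' , ℕ.m<n⇒m<1+n i'<j , eq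

small-satisfies : ∀ {n} (O : Ops (Fin n)) → IsSAlgebra O → ∀ M → n ≤ℕ M → O ⊨ someEquivalent (suc M) ≈ one
small-satisfies O S M n≤M ρ with Fin.pigeonhole (s≤s n≤M) (λ k → ρ (toℕ k))
... | i , j , i<j , e = SAlgebraFacts.someEquivalent-true S ρ (suc M) (toℕ i , toℕ j , i<j , Fin.toℕ<n j , e)

-- 2. Nelson chains

record InvolutiveChain : Set₁ where
  infix 4 _≤_ _≤?_
  infix 8 ~_
  field
    Carrier : Set
    _≤_ : Carrier → Carrier → Set
    _≤?_ : ∀ x y → Dec (x ≤ y)
    ≤-refl : ∀ {x} → x ≤ x
    ≤-trans : ∀ {x y z} → x ≤ y → y ≤ z → x ≤ z
    ≤-antisym : ∀ {x y} → x ≤ y → y ≤ x → x ≡ y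
    ≰⇒≥ : ∀ {x y} → ¬ x ≤ y → y ≤ x
    ~_ : Carrier → Carrier
    ~~ : ∀ x → ~ ~ x ≡ x
    ~-anti : ∀ {x y} → x ≤ y → ~ y ≤ ~ x
    bot : Carrier
    bot-least : ∀ x → bot ≤ x

module NelsonChain (C : InvolutiveChain) where
  open InvolutiveChain C renaming (Carrier to A)

  infixr 7 _⊓_
  infixr 6 _⊔_
  infixr 5 _⇒_

  top : A
  top = ~ bot

  _⊓_ : A → A → A
  x ⊓ y with x ≤? y
  ... | yes _ = x
  ... | no _ = y

  _⊔_ : A → A → A
  x ⊔ y with x ≤? y
  ... | yes _ = y
  ... | no _ = x

  _⇒_ : A → A → A
  x ⇒ y with x ≤? y
  ... | yes _ = top
  ... | no _ = ~ x ⊔ y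

  ⊓-lb₁ : ∀ {x y} → x ⊓ y ≤ x
  ⊓-lb₁ {x} {y} with x ≤? y
  ... | yes _ = ≤-refl
  ... | no x≰y = ≰⇒≥ x≰y

  ⊓-lb₂ : ∀ {x y} → x ⊓ y ≤ y
  ⊓-lb₂ {x} {y} with x ≤? y
  ... | yes x≤y = x≤y
  ... | no _ = ≤-refl

  ⊔-ub₁ : ∀ {x y} → x ≤ x ⊔ y
  ⊔-ub₁ {x} {y} with x ≤? y
  ... | yes x≤y = x≤y
  ... | no _ = ≤-refl

  ⊔-ub₂ : ∀ {x y} → y ≤ x ⊔ y
  ⊔-ub₂ {x} {y} with x ≤? y
  ... | yes _ = ≤-refl
  ... | no x≰y = ≰⇒≥ x≰y

  ⊔-lub : ∀ {x y z} → x ≤ z → y ≤ z → x ⊔ y ≤ z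
  ⊔-lub {x} {y} x≤z y≤z with x ≤? y
  ... | yes _ = y≤z
  ... | no _ = x≤z

  -- Meets and joins are selections, so every predicate is closed under them.
  ⊓-closed : ∀ (P : A → Set) {x y} → P x → P y → P (x ⊓ y)
  ⊓-closed P {x} {y} px py with x ≤? y
  ... | yes _ = px
  ... | no _ = py

  ⊔-closed : ∀ (P : A → Set) {x y} → P x → P y → P (x ⊔ y)
  ⊔-closed P {x} {y} px py with x ≤? y
  ... | yes _ = py
  ... | no _ = px

  ⊔-split : ∀ {x y z} → z ≤ x ⊔ y → z ≤ x ⊎ z ≤ y
  ⊔-split {x} {y} z≤x⊔y with x ≤? y
  ... | yes _ = inj₂ z≤x⊔y
  ... | no _ = inj₁ z≤x⊔y

  ⊔-comm : ∀ {x y} → x ⊔ y ≡ y ⊔ x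
  ⊔-comm = ≤-antisym (⊔-lub ⊔-ub₂ ⊔-ub₁) (⊔-lub ⊔-ub₂ ⊔-ub₁)

  ⊔-left-comm : ∀ {x y z} → x ⊔ (y ⊔ z) ≡ y ⊔ (x ⊔ z)
  ⊔-left-comm = ≤-antisym (⊔-lub (≤-trans ⊔-ub₁ ⊔-ub₂) (⊔-lub ⊔-ub₁ (≤-trans ⊔-ub₂ ⊔-ub₂)))
                          (⊔-lub (≤-trans ⊔-ub₁ ⊔-ub₂) (⊔-lub ⊔-ub₁ (≤-trans ⊔-ub₂ ⊔-ub₂)))

  ⊓-idem : ∀ {x} → x ⊓ x ≡ x
  ⊓-idem {x} with x ≤? x
  ... | yes _ = refl
  ... | no _ = refl

  ~-reflect : ∀ {x y} → ~ x ≤ ~ y → y ≤ x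
  ~-reflect {x} {y} p = subst₂ _≤_ (~~ y) (~~ x) (~-anti p)

  ~-swap : ∀ {x y} → x ≤ ~ y → y ≤ ~ x
  ~-swap {x} {y} p = subst (_≤ ~ x) (~~ y) (~-anti p)

  ~top : ~ top ≡ bot
  ~top = ~~ bot

  top-greatest : ∀ {x} → x ≤ top
  top-greatest {x} = ~-swap (bot-least (~ x))

  top-upward : ∀ {x y} → x ≤ y → x ≡ top → y ≡ top
  top-upward {x} {y} x≤y refl = ≤-antisym top-greatest x≤y

  ~-⊔ : ∀ {x y} → ~ (x ⊔ y) ≡ ~ x ⊓ ~ y
  ~-⊔ {x} {y} with x ≤? y | ~ x ≤? ~ y
  ... | yes x≤y | yes ~x≤~y = ≤-antisym (~-anti x≤y) ~x≤~y
  ... | yes _ | no _ = refl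
  ... | no _ | yes _ = refl
  ... | no x≰y | no ~x≰~y = ⊥-elim (~x≰~y (~-anti (≰⇒≥ x≰y)))

  ~-⊓ : ∀ {x y} → ~ (x ⊓ y) ≡ ~ x ⊔ ~ y
  ~-⊓ {x} {y} with x ≤? y | ~ x ≤? ~ y
  ... | yes x≤y | yes ~x≤~y = ≤-antisym ~x≤~y (~-anti x≤y)
  ... | yes _ | no _ = refl
  ... | no _ | yes _ = refl
  ... | no x≰y | no ~x≰~y = ⊥-elim (~x≰~y (~-anti (≰⇒≥ x≰y)))

  ~[~x⊔y] : ∀ {x y} → ~ (~ x ⊔ y) ≡ x ⊓ ~ y
  ~[~x⊔y] {x} {y} = trans ~-⊔ (cong (_⊓ ~ y) (~~ x))

  ⇒-true : ∀ {x y} → x ≤ y → x ⇒ y ≡ top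
  ⇒-true {x} {y} x≤y with x ≤? y
  ... | yes _ = refl
  ... | no x≰y = ⊥-elim (x≰y x≤y)

  ⇒-true⇒≤ : ∀ {x y} → x ⇒ y ≡ top → x ≤ y
  ⇒-true⇒≤ {x} {y} e with x ≤? y
  ... | yes x≤y = x≤y
  ... | no _ with ⊔-split (subst (top ≤_) (sym e) ≤-refl)
  ...   | inj₁ top≤~x = ≤-trans (~-swap top≤~x) (subst (_≤ y) (sym ~top) (bot-least y))
  ...   | inj₂ top≤y = ≤-trans top-greatest top≤y

  ⇒-ub : ∀ {x g} → g ≤ x ⇒ g
  ⇒-ub {x} {g} with x ≤? g
  ... | yes _ = top-greatest
  ... | no _ = ⊔-ub₂

  ⇒-monoʳ : ∀ {x y y'} → y ≤ y' → x ⇒ y ≤ x ⇒ y'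
  ⇒-monoʳ {x} {y} {y'} y≤y' with x ≤? y'
  ... | yes _ = top-greatest
  ... | no x≰y' with x ≤? y
  ...   | yes x≤y = ⊥-elim (x≰y' (≤-trans x≤y y≤y'))
  ...   | no _ = ⊔-lub ⊔-ub₁ (≤-trans y≤y' ⊔-ub₂)

  ⇛-true-upward : ∀ (Γ : List A) {a b} → a ≤ b → foldr _⇒_ a Γ ≡ top → foldr _⇒_ b Γ ≡ top
  ⇛-true-upward Γ a≤b = top-upward (⇛-mono Γ a≤b)
    where
    ⇛-mono : ∀ (Γ : List A) {a b} → a ≤ b → foldr _⇒_ a Γ ≤ foldr _⇒_ b Γ
    ⇛-mono [] a≤b = a≤b
    ⇛-mono (g ∷ Γ) a≤b = ⇒-monoʳ (⇛-mono Γ a≤b)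

  ⇒-mp : ∀ x y → x ≤ (x ⇒ y) ⇒ y
  ⇒-mp x y with x ≤? y
  ... | yes x≤y = ≤-trans x≤y ⇒-ub
  ... | no x≰y with ~ x ⊔ y ≤? y
  ...   | yes _ = top-greatest
  ...   | no u≰y = ≤-trans (~-swap (⊔-lub ≤-refl (≰⇒≥ (λ ~x≤y → u≰y (⊔-lub ~x≤y ≤-refl))))) ⊔-ub₁

  exchange-key : ∀ {x y g} → ¬ x ≤ g → x ≤ ~ y ⊔ g → y ≤ ~ x ⊔ g
  exchange-key x≰g x≤~y⊔g with ⊔-split x≤~y⊔g
  ... | inj₁ x≤~y = ≤-trans (~-swap x≤~y) ⊔-ub₁
  ... | inj₂ x≤g = ⊥-elim (x≰g x≤g)

  ⇒-exchange : ∀ x y g → x ⇒ (y ⇒ g) ≡ y ⇒ (x ⇒ g)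
  ⇒-exchange x y g with y ≤? g
  ... | yes y≤g = trans (⇒-true top-greatest) (sym (⇒-true (≤-trans y≤g ⇒-ub)))
  ... | no y≰g with x ≤? g
  ...   | yes x≤g = trans (⇒-true (≤-trans x≤g ⊔-ub₂)) (sym (⇒-true top-greatest))
  ...   | no x≰g with x ≤? ~ y ⊔ g | y ≤? ~ x ⊔ g
  ...     | yes _ | yes _ = refl
  ...     | no _ | no _ = ⊔-left-comm
  ...     | yes x≤ | no y≰ = ⊥-elim (y≰ (exchange-key x≰g x≤))
  ...     | no x≰ | yes y≤ = ⊥-elim (x≰ (exchange-key y≰g y≤))

  ⇒-contrapose : ∀ x y → x ⇒ y ≡ ~ y ⇒ ~ x
  ⇒-contrapose x y with x ≤? y | ~ y ≤? ~ x
  ... | yes _ | yes _ = refl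
  ... | yes x≤y | no ~y≰~x = ⊥-elim (~y≰~x (~-anti x≤y))
  ... | no x≰y | yes ~y≤~x = ⊥-elim (x≰y (~-reflect ~y≤~x))
  ... | no _ | no _ = trans ⊔-comm (cong (_⊔ ~ x) (sym (~~ y)))

  Negative : A → Set
  Negative c = c ≤ ~ c

  negative-⇒ : ∀ {x z} → Negative x → x ≤ x ⇒ z
  negative-⇒ {x} {z} x≤~x with x ≤? z
  ... | yes _ = top-greatest
  ... | no _ = ≤-trans x≤~x ⊔-ub₁

  ⇒-contract : ∀ {x g} → x ≤ x ⇒ (x ⇒ g) → x ≤ x ⇒ g
  ⇒-contract {x} {g} p with x ≤? (x ⇒ g)
  ... | yes x≤x⇒g = x≤x⇒g
  ... | no _ with ⊔-split p
  ...   | inj₁ x≤~x = negative-⇒ x≤~x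
  ...   | inj₂ x≤x⇒g = x≤x⇒g

  ⇒-negative : ∀ {g v} → ¬ Negative g → Negative v → Negative (g ⇒ v)
  ⇒-negative {g} {v} g≰~g v≤~v with g ≤? v
  ... | yes g≤v = ⊥-elim (g≰~g (≤-trans g≤v (≤-trans v≤~v (~-anti g≤v))))
  ... | no _ = ⊔-closed Negative (subst (~ g ≤_) (sym (~~ g)) (≰⇒≥ g≰~g)) v≤~v

  -- The invariant behind rule ¬⇒r: v lies below w, or v is negative.
  -- It is preserved by g ⇒² _ and transports truth from v to w.
  Below : A → A → Set
  Below v w = v ≤ w ⊎ Negative v

  Below-⇒² : ∀ g {v w} → Below v w → Below (g ⇒ (g ⇒ v)) (g ⇒ (g ⇒ w))
  Below-⇒² g (inj₁ v≤w) = inj₁ (⇒-monoʳ (⇒-monoʳ v≤w))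
  Below-⇒² g {v} {w} (inj₂ v≤~v) with g ≤? ~ g
  ... | yes g≤~g = inj₁ (subst (_ ≤_) (sym (⇒-true (negative-⇒ g≤~g))) top-greatest)
  ... | no g≰~g = inj₂ (⇒-negative g≰~g (⇒-negative g≰~g v≤~v))

  Below-⇛² : ∀ (Γ : List A) {v w} → Below v w
            → Below (foldr (λ g z → g ⇒ (g ⇒ z)) v Γ) (foldr (λ g z → g ⇒ (g ⇒ z)) w Γ)
  Below-⇛² [] b = b
  Below-⇛² (g ∷ Γ) b = Below-⇒² g (Below-⇛² Γ b)

  Below-true : ∀ {v w} → Below v w → v ≡ top → w ≡ top
  Below-true (inj₁ v≤w) e = top-upward v≤w e
  Below-true {v} {w} (inj₂ v≤~v) refl =
    ≤-antisym top-greatest (≤-trans v≤~v (subst (_≤ w) (sym ~top) (bot-least w)))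

  ¬⇒-Below : ∀ x y → Below (x ⊓ ~ y) (~ (x ⇒ y))
  ¬⇒-Below x y with x ≤? y
  ... | yes x≤y = inj₂ (≤-trans (≤-trans ⊓-lb₁ x≤y) (subst (_≤ ~ (x ⊓ ~ y)) (~~ y) (~-anti ⊓-lb₂)))
  ... | no _ = inj₁ (subst (_≤ ~ (~ x ⊔ y)) ~[~x⊔y] ≤-refl)

  ¬⇒-≤ : ∀ x y → ~ (x ⇒ y) ≤ x ⊓ ~ y
  ¬⇒-≤ x y with x ≤? y
  ... | yes _ = subst (_≤ x ⊓ ~ y) (sym ~top) (bot-least _)
  ... | no _ = subst (_≤ x ⊓ ~ y) (sym ~[~x⊔y]) ≤-refl

  ~≤⇒bot : ∀ x → ~ x ≤ x ⇒ bot
  ~≤⇒bot x with x ≤? bot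
  ... | yes _ = top-greatest
  ... | no _ = ⊔-ub₁

  ⇔-diag : ∀ z → (z ⇒ z) ⊓ (z ⇒ z) ≡ top
  ⇔-diag z = trans ⊓-idem (⇒-true ≤-refl)

  ⊔-prime : ∀ {x y} → x ⊔ y ≡ top → x ≡ top ⊎ y ≡ top
  ⊔-prime {x} {y} e with x ≤? y
  ... | yes _ = inj₂ e
  ... | no _ = inj₁ e

  ops : Ops A
  ops = record { _∧_ = _⊓_ ; _∨_ = _⊔_ ; _⇒_ = _⇒_ ; ¬_ = ~_ ; 𝟘 = bot ; 𝟙 = top }

  isSAlgebra : IsSAlgebra ops
  isSAlgebra = record
    { A1 = λ x → ⇒-true ≤-refl
    ; A2 = λ y → ⇒-true (bot-least y)
    ; A3 = λ x → ⇒-true (~≤⇒bot x)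
    ; A4 = refl
    ; A5 = λ x y → subst (λ u → (u ⇒ (~ y ⇒ ~ x)) ⊓ ((~ y ⇒ ~ x) ⇒ u) ≡ top)
                         (sym (⇒-contrapose x y)) (⇔-diag (~ y ⇒ ~ x))
    ; refl⇒ = λ x → ⇒-true ≤-refl
    ; rP = λ Γ x y g → subst (λ u → foldr _⇒_ u Γ ≡ top) (⇒-exchange x y g)
    ; rC = λ x g h → ⇒-true (⇒-contract (⇒-true⇒≤ h))
    ; rE = λ Γ x g h₁ h₂ → ⇛-true-upward Γ (⇒-true⇒≤ h₂) h₁
    ; r⇒l = λ Γ x y g h₁ h₂ → ⇛-true-upward Γ (≤-trans (⇒-mp x y) (⇒-monoʳ (⇒-true⇒≤ h₂))) h₁
    ; r⇒r = λ x g e → ⇒-true (subst (x ≤_) (sym e) top-greatest)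
    ; r∧l1 = λ x y g h → ⇒-true (≤-trans ⊓-lb₁ (⇒-true⇒≤ h))
    ; r∧l2 = λ x y g h → ⇒-true (≤-trans ⊓-lb₂ (⇒-true⇒≤ h))
    ; r∧r = λ Γ x y → ⊓-closed (λ u → foldr _⇒_ u Γ ≡ top)
    ; r∨l1 = λ x y g h₁ h₂ → ⇒-true (⊔-lub (⇒-true⇒≤ h₁) (⇒-true⇒≤ h₂))
    ; r∨l2 = λ x y g → ⊔-closed (λ u → u ⇒ (u ⇒ g) ≡ top)
    ; r∨r1 = λ Γ x y → ⇛-true-upward Γ ⊔-ub₁
    ; r∨r2 = λ Γ x y → ⇛-true-upward Γ ⊔-ub₂
    ; r¬⇒l = λ x y g h → ⇒-true (≤-trans (¬⇒-≤ x y) (⇒-true⇒≤ h))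
    ; r¬⇒r = λ Γ x y → Below-true (Below-⇛² Γ (¬⇒-Below x y))
    ; r¬∧l = λ x y g → subst (λ u → u ⇒ g ≡ top) (sym ~-⊓)
    ; r¬∧r = λ Γ x y → subst (λ u → foldr _⇒_ u Γ ≡ top) (sym ~-⊓)
    ; r¬∨l = λ x y g → subst (λ u → u ⇒ g ≡ top) (sym ~-⊔)
    ; r¬∨r = λ Γ x y → subst (λ u → foldr _⇒_ u Γ ≡ top) (sym ~-⊔)
    ; r¬¬l = λ x g → subst (λ u → u ⇒ g ≡ top) (sym (~~ x))
    ; r¬¬r = λ Γ x → subst (λ u → foldr _⇒_ u Γ ≡ top) (sym (~~ x))
    ; antisym = λ x y h₁ h₂ → ≤-antisym (⇒-true⇒≤ h₁) (⇒-true⇒≤ h₂)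
    }

-- 3. The infinite chain ω + ω*

-- inj₁ 0 < inj₁ 1 < … < inj₂ 1 < inj₂ 0.
Ω : Set
Ω = ℕ ⊎ ℕ

infix 4 _≼_

data _≼_ : Ω → Ω → Set where
  l≼l : ∀ {a b} → a ≤ℕ b → inj₁ a ≼ inj₁ b
  l≼r : ∀ {a b} → inj₁ a ≼ inj₂ b
  r≼r : ∀ {a b} → b ≤ℕ a → inj₂ a ≼ inj₂ b

_≼?_ : ∀ x y → Dec (x ≼ y)
inj₁ a ≼? inj₁ b with a ℕ.≤? b
... | yes a≤b = yes (l≼l a≤b)
... | no a≰b = no λ { (l≼l a≤b) → a≰b a≤b }
inj₁ a ≼? inj₂ b = yes l≼r
inj₂ a ≼? inj₁ b = no λ ()
inj₂ a ≼? inj₂ b with b ℕ.≤? a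
... | yes b≤a = yes (r≼r b≤a)
... | no b≰a = no λ { (r≼r b≤a) → b≰a b≤a }

≼-refl : ∀ {x} → x ≼ x
≼-refl {inj₁ a} = l≼l ℕ.≤-refl
≼-refl {inj₂ a} = r≼r ℕ.≤-refl

≼-trans : ∀ {x y z} → x ≼ y → y ≼ z → x ≼ z
≼-trans (l≼l p) (l≼l q) = l≼l (ℕ.≤-trans p q)
≼-trans (l≼l p) l≼r = l≼r
≼-trans l≼r (r≼r q) = l≼r
≼-trans (r≼r p) (r≼r q) = r≼r (ℕ.≤-trans q p)

≼-antisym : ∀ {x y} → x ≼ y → y ≼ x → x ≡ y
≼-antisym (l≼l p) (l≼l q) = cong inj₁ (ℕ.≤-antisym p q)
≼-antisym (r≼r p) (r≼r q) = cong inj₂ (ℕ.≤-antisym q p)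

⋠⇒≽ : ∀ {x y} → ¬ x ≼ y → y ≼ x
⋠⇒≽ {inj₁ a} {inj₁ b} x⋠y = l≼l (ℕ.≰⇒≥ (λ a≤b → x⋠y (l≼l a≤b)))
⋠⇒≽ {inj₁ a} {inj₂ b} x⋠y = ⊥-elim (x⋠y l≼r)
⋠⇒≽ {inj₂ a} {inj₁ b} x⋠y = l≼r
⋠⇒≽ {inj₂ a} {inj₂ b} x⋠y = r≼r (ℕ.≰⇒≥ (λ b≤a → x⋠y (r≼r b≤a)))

mirror : Ω → Ω
mirror (inj₁ a) = inj₂ a
mirror (inj₂ a) = inj₁ a

mirror-involutive : ∀ x → mirror (mirror x) ≡ x
mirror-involutive (inj₁ a) = refl
mirror-involutive (inj₂ a) = refl

mirror-anti : ∀ {x y} → x ≼ y → mirror y ≼ mirror x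
mirror-anti (l≼l p) = r≼r p
mirror-anti l≼r = l≼r
mirror-anti (r≼r p) = l≼l p

Ω-least : ∀ x → inj₁ 0 ≼ x
Ω-least (inj₁ a) = l≼l z≤n
Ω-least (inj₂ a) = l≼r

ω+ω* : InvolutiveChain
ω+ω* = record
  { Carrier = Ω ; _≤_ = _≼_ ; _≤?_ = _≼?_
  ; ≤-refl = ≼-refl ; ≤-trans = ≼-trans ; ≤-antisym = ≼-antisym ; ≰⇒≥ = ⋠⇒≽
  ; ~_ = mirror ; ~~ = mirror-involutive ; ~-anti = mirror-anti
  ; bot = inj₁ 0 ; bot-least = Ω-least
  }

module ΩChain = NelsonChain ω+ω*

module ΩFacts = SAlgebraFacts.WellConnected ΩChain.isSAlgebra (λ ()) ΩChain.⊔-prime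

Ω-violates : ∀ k → ¬ ΩChain.ops ⊨ someEquivalent k ≈ one
Ω-violates k holds with ΩFacts.someEquivalent-collision inj₁ k (holds inj₁)
... | i , j , i<j , _ , e = ℕ.<-irrefl (inj₁-injective e) i<j

-- 4. The theorem

totalSize : List FinAlg → ℕ
totalSize [] = 0
totalSize (B ∷ K) = proj₁ B + totalSize K

size≤totalSize : ∀ {K B} → B ∈ K → proj₁ B ≤ℕ totalSize K
size≤totalSize (here refl) = ℕ.m≤m+n _ _
size≤totalSize {B' ∷ K} (there B∈K) = ℕ.≤-trans (size≤totalSize B∈K) (ℕ.m≤n+m _ (proj₁ B'))

proposition6p7 : ¬ Σ (List FinAlg) SAlgIsGeneratedBy
proposition6p7 (K , generates) = Ω-violates (suc M) Ω-satisfies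
  where
  M : ℕ
  M = totalSize K

  member-isS : ∀ {B} → B ∈ K → IsSAlgebra (proj₂ B)
  member-isS {B} B∈K = proj₂ (generates (Fin (proj₁ B)) (proj₂ B)) (λ t s all → All.lookup all B∈K)

  members-satisfy : All (λ B → proj₂ B ⊨ someEquivalent (suc M) ≈ one) K
  members-satisfy = All.tabulate (λ {B} B∈K → small-satisfies (proj₂ B) (member-isS B∈K) M (size≤totalSize B∈K))

  Ω-satisfies : ΩChain.ops ⊨ someEquivalent (suc M) ≈ one
  Ω-satisfies = proj₁ (generates Ω ΩChain.ops) ΩChain.isSAlgebra (someEquivalent (suc M)) one members-satisfy
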